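{- On $r$-row non-skew fluctuating tableaux of length $n$ we have (i) $\mathcal P=\mathrm{BK}_{n-1}\circ\cdots\circ\mathrm{BK}_1$; (ii) $\mathcal E=\mathrm{BK}_1\circ(\mathrm{BK}_2\circ\mathrm{BK}_1)\circ\cdots\circ(\mathrm{BK}_{n-1}\circ\cdots\circ\mathrm{BK}_1)$; (iii) $\mathcal E^*=(\mathrm{BK}_{n-1}\circ\cdots\circ\mathrm{BK}_1)\circ\cdots\circ(\mathrm{BK}_{n-1}\circ\mathrm{BK}_{n-2})\circ\mathrm{BK}_{n-1}$.
   Context: An $r$-row generalized partition is $\lambda\in\mathbb Z^r$ with $\lambda_1\ge\cdots\ge\lambda_r$. $\mathcal A_r$ is the set of subsets $S\subseteq\{\pm1,\ldots,\pm r\}$ with all elements of the same sign (including $\emptyset$); $\mathbf e_S=\sum_{s\in S}\mathbf e_s$ if $S$ is positive and $-\sum_{s\in S}\mathbf e_{ -s}$ if negative. An $r$-row fluctuating tableau of length $n$ is a sequence $T=(\lambda^0,\ldots,\lambda^n)$ of $r$-row generalized partitions with $\lambda^k-\lambda^{k-1}=\mathbf e_{S_k}$, $S_k\in\mathcal A_r$; non-skew if $\lambda^0=0$. $\mathrm{sort}(\alpha)$ is the weakly decreasing rearrangement of $\alpha\in\mathbb Z^r$. Bender–Knuth involution: for $1\le i\le n-1$, $\mathrm{BK}_i(T)$ is obtained from $T$ by replacing $\lambda^i$ with $\mathrm{sort}(\lambda^{i+1}+\lambda^{i-1}-\lambda^i)$, all other terms unchanged. Promotion and evacuation: let $(\lambda^{i,j})_{0\le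 i\le n,\,i\le j\le n+i}$ be given by $\lambda^{0,j}=\lambda^j$, $\lambda^{i,i}=\lambda^0$, $\lambda^{i,n+i}=\lambda^n$, and $\lambda^{i,j}=\mathrm{sort}(\lambda^{i-1,j}+\lambda^{i,j-1}-\lambda^{i-1,j-1})$ for $1\le i\le n$, $i<j<n+i$ (increasing $i$, then $j$). Then $\mathcal P(T)=(\lambda^{1,1},\ldots,\lambda^{1,n+1})$ and $\mathcal E(T)=(\lambda^{n,n},\lambda^{n-1,n},\ldots,\lambda^{0,n})$. Dual evacuation: let $(\mu^{i,j})_{ -n\le i\le0,\,0\le j\le n+i}$ be given by $\mu^{0,j}=\lambda^j$, $\mu^{i,n+i}=\lambda^n$ for $-n\le i\le-1$, and $\mu^{i-1,j-1}=\mathrm{sort}(\mu^{i-1,j}+\mu^{i,j-1}-\mu^{i,j})$ for $-n+1\le i\le0$, $1\le j\le n+i-1$ (computed in order of decreasing $i$, and for fixed $i$ decreasing $j$). Then $\mathcal E^*(T)=(\mu^{0,0},\mu^{ -1,0},\ldots,\mu^{ -n,0})$. -}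

module Defs where

open import Data.Bool using (Bool; true; false; if_then_else_; _∧_)
open import Data.Nat as ℕ using (ℕ; zero; suc; _∸_; _≟_; _<ᵇ_)
open import Data.Integer as ℤ using (ℤ; 0ℤ; 1ℤ; -1ℤ; _≤ᵇ_)
open import Data.Fin as Fin using (Fin; inject₁)
open import Data.Fin.Subset using (Subset; inside)
open import Data.Vec using (Vec; []; _∷_; lookup; tabulate; replicate; zipWith; head)
open import Data.Product using (Σ; ∃; _×_; _,_)
open import Relation.Nullary using (yes; no)
open import Relation.Binary.PropositionalEquality using (_≡_)

ℤVec : ℕ → Set
ℤVec r = Vec ℤ r

zeroV : ∀ {r} → ℤVec r
zeroV = replicate _ 0ℤ

_⊕_ : ∀ {r} → ℤVec r → ℤVec r → ℤVec r
_⊕_ = zipWith ℤ._+_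

_⊖_ : ∀ {r} → ℤVec r → ℤVec r → ℤVec r
_⊖_ = zipWith ℤ._-_

insertDesc : ∀ {m} → ℤ → Vec ℤ m → Vec ℤ (suc m)
insertDesc x [] = x ∷ []
insertDesc x (y ∷ ys) = if y ≤ᵇ x then x ∷ y ∷ ys else y ∷ insertDesc x ys

sort : ∀ {m} → Vec ℤ m → Vec ℤ m
sort [] = []
sort (x ∷ xs) = insertDesc x (sort xs)

IsGenPartition : ∀ {r} → ℤVec r → Set
IsGenPartition {r} v = (i j : Fin r) → i Fin.≤ j → lookup v j ℤ.≤ lookup v i

-- 𝒜_r : a sign together with a subset of {1..r}; (true , S) stands for
-- the positive set S, (false , S) for the negative set -S.
𝒜 : ℕ → Set
𝒜 r = Bool × Subset r

e : ∀ {r} → 𝒜 r → ℤVec r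
e (true  , S) = tabulate λ i → if isIn (lookup S i) then 1ℤ else 0ℤ
  where isIn : _ → Bool
        isIn inside = true
        isIn _      = false
e (false , S) = tabulate λ i → if isIn (lookup S i) then -1ℤ else 0ℤ
  where isIn : _ → Bool
        isIn inside = true
        isIn _      = false

Seq : ℕ → ℕ → Set
Seq r n = Vec (ℤVec r) (suc n)

IsFluctuatingTableau : ∀ {r n} → Seq r n → Set
IsFluctuatingTableau {r} {n} T =
  ((k : Fin (suc n)) → IsGenPartition (lookup T k)) ×
  ((k : Fin n) → ∃ λ (S : 𝒜 r) →
      lookup T (Fin.suc k) ⊖ lookup T (inject₁ k) ≡ e S)

NonSkew : ∀ {r n} → Seq r n → Set
NonSkew T = head T ≡ zeroV

-- safe lookup with ℕ index (out-of-range: zero vector; never used in range)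
at : ∀ {r m} → Vec (ℤVec r) m → ℕ → ℤVec r
at [] _ = zeroV
at (x ∷ xs) zero = x
at (x ∷ xs) (suc j) = at xs j

-- Bender–Knuth involution BK_i (0-indexed entries λ⁰..λⁿ):
-- replaces λ^i by sort(λ^{i+1} + λ^{i-1} - λ^i).
-- For i = 0 or i ≥ n it is the identity (only 1 ≤ i ≤ n-1 is used).

bkV : ∀ {r m} → ℕ → Vec (ℤVec r) m → Vec (ℤVec r) m
bkV zero xs = xs
bkV (suc zero) (x ∷ y ∷ z ∷ rest) = x ∷ sort ((z ⊕ x) ⊖ y) ∷ z ∷ rest
bkV (suc zero) xs = xs
bkV (suc (suc i)) [] = []
bkV (suc (suc i)) (x ∷ rest) = x ∷ bkV (suc i) rest

BK : ∀ {r n} → ℕ → Seq r n → Seq r n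
BK = bkV

upFrom : ∀ {r n} → ℕ → ℕ → Seq r n → Seq r n
upFrom a zero T = T
upFrom a (suc k) T = upFrom (suc a) k (BK a T)

bkUp : ∀ {r n} → ℕ → Seq r n → Seq r n
bkUp k = upFrom 1 k

-- evacBK m = BK_1 ∘ (BK_2 ∘ BK_1) ∘ ⋯ ∘ (BK_m ∘ ⋯ ∘ BK_1)
evacBK : ∀ {r n} → ℕ → Seq r n → Seq r n
evacBK zero T = T
evacBK (suc m) T = evacBK m (bkUp (suc m) T)

-- dualEvacBK n c = seg 1 ∘ seg 2 ∘ ⋯ ∘ seg c  where
-- seg j = BK_{n-1} ∘ ⋯ ∘ BK_{j+1} ∘ BK_j = upFrom j (n ∸ j)
dualEvacBK : ∀ {r n} → ℕ → ℕ → Seq r n → Seq r n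
dualEvacBK N zero T = T
dualEvacBK N (suc c) T = dualEvacBK N c (upFrom (suc c) (N ∸ suc c) T)

-- Promotion / evacuation grid λ^{i,j}  (lam T i j), following the
-- paper's recursion verbatim; entries outside 0≤i≤n, i≤j≤n+i are
-- set to the zero vector (they are never used).

lam : ∀ {r n} → Seq r n → ℕ → ℕ → ℤVec r
lam T zero j = at T j
lam T (suc i) zero = zeroV
lam {n = n} T (suc i) (suc j) with j ≟ i | suc j ≟ n ℕ.+ suc i
... | yes _ | _     = at T 0
... | no _  | yes _ = at T n
... | no _  | no _  =
  if (i <ᵇ j) ∧ (suc j <ᵇ n ℕ.+ suc i) ∧ (i <ᵇ n)
  then sort ((lam T i (suc j) ⊕ lam T (suc i) j) ⊖ lam T i j)
  else zeroV

promotion : ∀ {r n} → Seq r n → Seq r n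
promotion T = tabulate λ k → lam T 1 (suc (Fin.toℕ k))

evacuation : ∀ {r n} → Seq r n → Seq r n
evacuation {n = n} T = tabulate λ k → lam T (n ∸ Fin.toℕ k) n

-- We write μ^{-k,j} (0 ≤ k ≤ n, 0 ≤ j ≤ n-k) as
-- nu T k d with d = n - k - j (distance to the right boundary), so that
-- the paper's recursion
--   μ^{i-1,j-1} = sort(μ^{i-1,j} + μ^{i,j-1} - μ^{i,j})
-- becomes, with i = -k, j-1 = n-(k+1)-d :
--   nu (k+1) d = sort(nu (k+1) (d-1) + nu k (d+1) - nu k d),  1 ≤ d ≤ n-k-1,
-- with boundary values nu 0 d = λ^{n-d}, nu (k+1) 0 = λ^n.

nu : ∀ {r n} → Seq r n → ℕ → ℕ → ℤVec r
nu {n = n} T zero d = at T (n ∸ d)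
nu {n = n} T (suc k) zero = at T n
nu {n = n} T (suc k) (suc d) =
  if (k <ᵇ n) ∧ (d <ᵇ n ∸ suc k)
  then sort ((nu T (suc k) d ⊕ nu T k (suc (suc d))) ⊖ nu T k (suc d))
  else zeroV

mu : ∀ {r n} → Seq r n → ℕ → ℕ → ℤVec r
mu {n = n} T k j = nu T k (n ∸ k ∸ j)

dualEvacuation : ∀ {r n} → Seq r n → Seq r n
dualEvacuation T = tabulate λ k → mu T (Fin.toℕ k) 0

-- Each of 𝒫, ℰ and ℰ* fills a grid by the local rule  x ↦ sort (up + left − diagonal).
-- Filling a row (for ℰ* an antidiagonal) from left to right is a Bender–Knuth sweep
-- BK_{a+k-1} ∘ ⋯ ∘ BK_a applied to the sequence holding the previous row: BK_i recomputes
-- position i from its right neighbour, which still belongs to the old row, and its left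
-- neighbour, which the sweep has already moved to the new row.  Promotion is one such
-- sweep; evacuation and dual evacuation are n − 1 stacked sweeps, one per row of their grids.
module Submission where

open import Defs
open import Data.Nat using (ℕ; zero; suc; _∸_; _+_; _≤_; _<_; _≟_; _≤?_; _<ᵇ_; z≤n; s≤s; z<s)
open import Data.Nat.Properties
open import Data.Bool using (true)
open import Data.Bool.Properties using (T-≡)
open import Data.Product using (_×_; _,_)
open import Data.Sum using (_⊎_; inj₁; inj₂)
open import Data.Vec using (Vec; []; _∷_; tabulate)
open import Data.Fin using (toℕ)
open import Data.Empty using (⊥-elim)
open import Function using (_∘_)
open import Function.Bundles using (Equivalence)
open import Relation.Nullary using (yes; no)
open import Relation.Binary.PropositionalEquality

private variable
  r m n : ℕ

toggle : ℤVec r → ℤVec r → ℤVec r → ℤVec r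
toggle x y z = sort ((x ⊕ y) ⊖ z)

<⇒<ᵇ≡true : ∀ {i j} → i < j → (i <ᵇ j) ≡ true
<⇒<ᵇ≡true i<j = Equivalence.to T-≡ (<⇒<ᵇ i<j)

m∸n≡1+m∸[1+n] : ∀ {i j} → j < i → i ∸ j ≡ suc (i ∸ suc j)
m∸n≡1+m∸[1+n] {suc i} {zero}  _         = refl
m∸n≡1+m∸[1+n] {suc i} {suc j} (s≤s j<i) = m∸n≡1+m∸[1+n] j<i

1+t<n⇒1+[i+[1+t]]<n+[1+i] : ∀ i {t n} → suc t < n → suc (i + suc t) < n + suc i
1+t<n⇒1+[i+[1+t]]<n+[1+i] i {t} {n} t+1<n = begin-strict
  suc (i + suc t)  ≡⟨ +-suc i (suc t) ⟨
  i + suc (suc t)  ≤⟨ +-monoʳ-≤ i t+1<n ⟩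
  i + n            <⟨ n<1+n (i + n) ⟩
  suc (i + n)      ≡⟨ cong suc (+-comm i n) ⟩
  suc (n + i)      ≡⟨ +-suc n i ⟨
  n + suc i        ∎
  where open ≤-Reasoning

at-ext : (xs ys : Vec (ℤVec r) m) → (∀ t → t < m → at xs t ≡ at ys t) → xs ≡ ys
at-ext []       []       eq = refl
at-ext (x ∷ xs) (y ∷ ys) eq = cong₂ _∷_ (eq 0 z<s) (at-ext xs ys λ t t<m → eq (suc t) (s≤s t<m))

at-tabulate : (f : ℕ → ℤVec r) → ∀ t → t < m → at {r} {m} (tabulate (f ∘ toℕ)) t ≡ f t
at-tabulate {m = suc m} f zero    _         = refl
at-tabulate {m = suc m} f (suc t) (s≤s t<m) = at-tabulate {m = m} (f ∘ suc) t t<m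

at-bkV-≢ : ∀ i (xs : Vec (ℤVec r) m) {j} → j ≢ i → at (bkV i xs) j ≡ at xs j
at-bkV-≢ zero          xs                               j≢i = refl
at-bkV-≢ (suc zero)    []                               j≢i = refl
at-bkV-≢ (suc zero)    (x ∷ [])                         j≢i = refl
at-bkV-≢ (suc zero)    (x ∷ y ∷ [])                     j≢i = refl
at-bkV-≢ (suc zero)    (x ∷ y ∷ z ∷ xs) {zero}          j≢i = refl
at-bkV-≢ (suc zero)    (x ∷ y ∷ z ∷ xs) {suc zero}      j≢i = ⊥-elim (j≢i refl)
at-bkV-≢ (suc zero)    (x ∷ y ∷ z ∷ xs) {suc (suc j)}   j≢i = refl
at-bkV-≢ (suc (suc i)) []                               j≢i = refl
at-bkV-≢ (suc (suc i)) (x ∷ xs)         {zero}          j≢i = refl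
at-bkV-≢ (suc (suc i)) (x ∷ xs)         {suc j}         j≢i = at-bkV-≢ (suc i) xs (j≢i ∘ cong suc)

at-bkV-self : ∀ i (xs : Vec (ℤVec r) m) → suc (suc i) < m →
  at (bkV (suc i) xs) (suc i) ≡ toggle (at xs (suc (suc i))) (at xs i) (at xs (suc i))
at-bkV-self zero    (x ∷ y ∷ z ∷ xs) _         = refl
at-bkV-self zero    (x ∷ y ∷ [])     (s≤s (s≤s ()))
at-bkV-self zero    (x ∷ [])         (s≤s ())
at-bkV-self (suc i) (x ∷ xs)         (s≤s i<m) = at-bkV-self i xs i<m

upFrom-outside : ∀ a k (U : Seq r n) t → t < a ⊎ a + k ≤ t → at (upFrom a k U) t ≡ at U t
upFrom-outside a zero    U t outside = refl
upFrom-outside a (suc k) U t outside =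
  trans (upFrom-outside (suc a) k (bkV a U) t (shift outside)) (at-bkV-≢ a U (≢a outside))
  where
  shift : t < a ⊎ a + suc k ≤ t → t < suc a ⊎ suc a + k ≤ t
  shift (inj₁ t<a) = inj₁ (m<n⇒m<1+n t<a)
  shift (inj₂ a+k≤t) = inj₂ (subst (_≤ t) (+-suc a k) a+k≤t)
  ≢a : t < a ⊎ a + suc k ≤ t → t ≢ a
  ≢a (inj₁ t<a) refl = <-irrefl refl t<a
  ≢a (inj₂ a+k≤t) refl = <⇒≱ (m<m+n a z<s) a+k≤t

upFrom-inside : ∀ a k (U : Seq r n) (g : ℕ → ℤVec r) → a + k < n → g a ≡ at U a →
  (∀ t → a ≤ t → t < a + k → g (suc t) ≡ toggle (at U (suc (suc t))) (g t) (at U (suc t))) →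
  ∀ t → a ≤ t → t < a + k → at (upFrom (suc a) k U) (suc t) ≡ g (suc t)
upFrom-inside a zero U g _ _ _ t a≤t t<a+0 =
  ⊥-elim (<⇒≱ t<a+0 (subst (_≤ t) (sym (+-identityʳ a)) a≤t))
upFrom-inside {n = n} a (suc k) U g a+k<n g₀ rec t a≤t t<a+k = byPosition (m≤n⇒m<n∨m≡n a≤t)
  where
  open ≡-Reasoning
  U′ = bkV (suc a) U
  first : at U′ (suc a) ≡ g (suc a)
  first = begin
    at U′ (suc a)                                        ≡⟨ at-bkV-self a U (s≤s (≤-<-trans (m<m+n a z<s) a+k<n)) ⟩
    toggle (at U (suc (suc a))) (at U a) (at U (suc a))  ≡⟨ cong (λ y → toggle (at U (suc (suc a))) y (at U (suc a))) g₀ ⟨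
    toggle (at U (suc (suc a))) (g a) (at U (suc a))     ≡⟨ rec a ≤-refl (m<m+n a z<s) ⟨
    g (suc a)                                            ∎
  rec′ : ∀ u → suc a ≤ u → u < suc a + k → g (suc u) ≡ toggle (at U′ (suc (suc u))) (g u) (at U′ (suc u))
  rec′ u a<u u<a+k
    rewrite at-bkV-≢ (suc a) U (>⇒≢ (s≤s (m<n⇒m<1+n a<u))) | at-bkV-≢ (suc a) U (>⇒≢ (s≤s a<u))
    = rec u (<⇒≤ a<u) (subst (u <_) (sym (+-suc a k)) u<a+k)
  byPosition : a < t ⊎ a ≡ t → at (upFrom (suc a) (suc k) U) (suc t) ≡ g (suc t)
  byPosition (inj₂ refl) = trans (upFrom-outside (suc (suc a)) k U′ (suc a) (inj₁ ≤-refl)) first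
  byPosition (inj₁ a<t) =
    upFrom-inside (suc a) k U′ g (subst (_< n) (+-suc a k) a+k<n) (sym first) rec′
      t a<t (subst (t <_) (+-suc a k) t<a+k)

module _ (T : Seq r n) where

  lam-diagonal : ∀ i → lam T i i ≡ at T 0
  lam-diagonal zero = refl
  lam-diagonal (suc i) with i ≟ i
  ... | yes _  = refl
  ... | no i≢i = ⊥-elim (i≢i refl)

  lam-rightBoundary : ∀ i j → suc j ≡ n + suc i → lam T (suc i) (suc j) ≡ at T n
  lam-rightBoundary i j eq with j ≟ i | suc j ≟ n + suc i
  ... | yes refl | _     = cong (at T) (+-cancelʳ-≡ (suc i) 0 n eq)
  ... | no _     | yes _ = refl
  ... | no _     | no ≢  = ⊥-elim (≢ eq)

  lam-interior : ∀ i j → i < j → suc j < n + suc i → i < n →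
    lam T (suc i) (suc j) ≡ toggle (lam T i (suc j)) (lam T (suc i) j) (lam T i j)
  lam-interior i j i<j j<n+i i<n with j ≟ i | suc j ≟ n + suc i
  ... | yes refl | _     = ⊥-elim (<-irrefl refl i<j)
  ... | no _     | yes e = ⊥-elim (<-irrefl e j<n+i)
  ... | no _     | no _
    rewrite <⇒<ᵇ≡true i<j | <⇒<ᵇ≡true j<n+i | <⇒<ᵇ≡true i<n = refl

  lam-interior-row : ∀ i t → i < n → suc t < n →
    lam T (suc i) (suc i + suc t)
      ≡ toggle (lam T i (i + suc (suc t))) (lam T (suc i) (suc i + t)) (lam T i (i + suc t))
  lam-interior-row i t i<n t+1<n = begin
    lam T (suc i) (suc (i + suc t))
      ≡⟨ lam-interior i (i + suc t) (m<m+n i z<s) (1+t<n⇒1+[i+[1+t]]<n+[1+i] i t+1<n) i<n ⟩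
    toggle (lam T i (suc (i + suc t))) (lam T (suc i) (i + suc t)) (lam T i (i + suc t))
      ≡⟨ cong₂ (λ x y → toggle x y (lam T i (i + suc t)))
           (cong (lam T i) (+-suc i (suc t))) (cong (lam T (suc i)) (sym (+-suc i t))) ⟨
    toggle (lam T i (i + suc (suc t))) (lam T (suc i) (suc (i + t))) (lam T i (i + suc t)) ∎
    where open ≡-Reasoning

  nu-rightBoundary : ∀ k → nu T k 0 ≡ at T n
  nu-rightBoundary zero    = refl
  nu-rightBoundary (suc k) = refl

  nu-interior : ∀ k d → k < n → d < n ∸ suc k →
    nu T (suc k) (suc d) ≡ toggle (nu T (suc k) d) (nu T k (suc (suc d))) (nu T k (suc d))
  nu-interior k d k<n d<n∸k rewrite <⇒<ᵇ≡true k<n | <⇒<ᵇ≡true d<n∸k = refl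

  nu-interior-at : ∀ c u → c ≤ u → suc u < n →
    nu T (suc u ∸ c) (n ∸ suc u)
      ≡ toggle (nu T (suc u ∸ c) (n ∸ suc (suc u))) (nu T (u ∸ c) (n ∸ u)) (nu T (u ∸ c) (n ∸ suc u))
  nu-interior-at c u c≤u u+1<n
    rewrite +-∸-assoc 1 c≤u
          | m∸n≡1+m∸[1+n] (<-trans (n<1+n u) u+1<n)
          | m∸n≡1+m∸[1+n] u+1<n
    = nu-interior (u ∸ c) (n ∸ suc (suc u)) (≤-<-trans (m∸n≤m u c) (<-trans (n<1+n u) u+1<n)) d<
    where
    d< : n ∸ suc (suc u) < n ∸ suc (u ∸ c)
    d< = ≤-trans (≤-reflexive (sym (m∸n≡1+m∸[1+n] u+1<n))) (∸-monoʳ-≤ n (s≤s (m∸n≤m u c)))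

  nu-leftColumn : ∀ t → t ≤ n → nu T 0 (n ∸ t) ≡ at T t
  nu-leftColumn t t≤n = cong (at T) (m∸[m∸n]≡n t≤n)

upFrom-lamRow : (T U : Seq r n) (p k : ℕ) → p < n → k < n →
  (∀ t → t ≤ suc k → at U t ≡ lam T p (p + t)) →
  ∀ t → t ≤ k → at (upFrom 1 k U) t ≡ lam T (suc p) (suc p + t)
upFrom-lamRow {r = r} T U p k p<n k<n row = byPosition
  where
  open ≡-Reasoning
  g : ℕ → ℤVec r
  g t = lam T (suc p) (suc p + t)
  g₀ : g 0 ≡ at U 0
  g₀ = begin
    lam T (suc p) (suc p + 0)  ≡⟨ cong (lam T (suc p)) (+-identityʳ (suc p)) ⟩
    lam T (suc p) (suc p)      ≡⟨ lam-diagonal T (suc p) ⟩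
    at T 0                     ≡⟨ lam-diagonal T p ⟨
    lam T p p                  ≡⟨ cong (lam T p) (+-identityʳ p) ⟨
    lam T p (p + 0)            ≡⟨ row 0 z≤n ⟨
    at U 0                     ∎
  rec : ∀ u → 0 ≤ u → u < 0 + k → g (suc u) ≡ toggle (at U (suc (suc u))) (g u) (at U (suc u))
  rec u _ u<k = trans (lam-interior-row T p u p<n (≤-<-trans u<k k<n))
    (sym (cong₂ (λ x z → toggle x (g u) z) (row (suc (suc u)) (s≤s u<k)) (row (suc u) (m≤n⇒m≤1+n u<k))))
  byPosition : ∀ t → t ≤ k → at (upFrom 1 k U) t ≡ g t
  byPosition zero    _   = trans (upFrom-outside 1 k U 0 (inj₁ z<s)) (sym g₀)
  byPosition (suc t) t<k = upFrom-inside 0 k U g k<n g₀ rec t z≤n t<k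

promotion≡bkUp : (T : Seq r (suc n)) → promotion T ≡ bkUp n T
promotion≡bkUp {n = n} T = at-ext _ _ λ t t<n+2 →
  trans (at-tabulate (λ t → lam T 1 (suc t)) t t<n+2) (sym (byPosition t t<n+2))
  where
  byPosition : ∀ t → t < suc (suc n) → at (upFrom 1 n T) t ≡ lam T 1 (suc t)
  byPosition t (s≤s t≤n+1) with m≤n⇒m<n∨m≡n t≤n+1
  ... | inj₁ (s≤s t≤n) = upFrom-lamRow T T 0 n z<s ≤-refl (λ _ _ → refl) t t≤n
  ... | inj₂ refl      = trans (upFrom-outside 1 n T (suc n) (inj₂ ≤-refl))
                               (sym (lam-rightBoundary T 0 (suc n) (+-comm 1 (suc n))))

evacBK-lamColumn : (T U : Seq r n) (m p : ℕ) → p + suc m ≡ n →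
  (∀ t → t ≤ suc m → at U t ≡ lam T p (p + t)) →
  (∀ t → suc m ≤ t → t ≤ n → at U t ≡ lam T (n ∸ t) n) →
  ∀ t → t ≤ n → at (evacBK m U) t ≡ lam T (n ∸ t) n
evacBK-lamColumn {n = n} T U zero p _ row column zero _ =
  trans (row 0 z≤n) (trans (cong (lam T p) (+-identityʳ p))
    (trans (lam-diagonal T p) (sym (lam-diagonal T n))))
evacBK-lamColumn T U zero p _ row column (suc t) t<n = column (suc t) (s≤s z≤n) t<n
evacBK-lamColumn {n = n} T U (suc m) p fills row column =
  evacBK-lamColumn T U′ m (suc p) fills′ row′ column′
  where
  U′ = upFrom 1 (suc m) U
  fills′ : suc p + suc m ≡ n
  fills′ = trans (sym (+-suc p (suc m))) fills
  row′ : ∀ t → t ≤ suc m → at U′ t ≡ lam T (suc p) (suc p + t)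
  row′ = upFrom-lamRow T U p (suc m)
    (subst (p <_) fills (m<m+n p z<s)) (subst (suc m <_) fills (m≤n+m (suc (suc m)) p)) row
  column′ : ∀ t → suc m ≤ t → t ≤ n → at U′ t ≡ lam T (n ∸ t) n
  column′ t m<t t≤n with m≤n⇒m<n∨m≡n m<t
  ... | inj₁ m+1<t = trans (upFrom-outside 1 (suc m) U t (inj₂ m+1<t)) (column t m+1<t t≤n)
  ... | inj₂ refl  = trans (row′ (suc m) ≤-refl) (cong₂ (lam T) p+1≡n∸t fills′)
    where
    p+1≡n∸t : suc p ≡ n ∸ suc m
    p+1≡n∸t = trans (sym (m+n∸n≡m (suc p) (suc m))) (cong (_∸ suc m) fills′)

evacuation≡evacBK : (T : Seq r (suc n)) → evacuation T ≡ evacBK n T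
evacuation≡evacBK {n = n} T = at-ext _ _ λ t t<n+2 →
  trans (at-tabulate (λ t → lam T (suc n ∸ t) (suc n)) t t<n+2)
    (sym (evacBK-lamColumn T T n 0 refl (λ _ _ → refl) lastColumn t (≤-pred t<n+2)))
  where
  lastColumn : ∀ t → suc n ≤ t → t ≤ suc n → at T t ≡ lam T (suc n ∸ t) (suc n)
  lastColumn t n+1≤t t≤n+1 with ≤-antisym n+1≤t t≤n+1
  ... | refl rewrite n∸n≡0 n = refl

upFrom-nuStage : (T U : Seq r n) (c : ℕ) → c < n →
  (∀ t → t ≤ n → at U t ≡ nu T (t ∸ suc c) (n ∸ t)) →
  ∀ t → t ≤ n → at (upFrom (suc c) (n ∸ suc c) U) t ≡ nu T (t ∸ c) (n ∸ t)
upFrom-nuStage {r = r} {n = n} T U c c<n stage = byPosition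
  where
  k = n ∸ suc c
  fills : suc c + k ≡ n
  fills = m+[n∸m]≡n c<n
  g : ℕ → ℤVec r
  g u = nu T (u ∸ c) (n ∸ u)
  g₀ : g c ≡ at U c
  g₀ = trans (cong (λ z → nu T z (n ∸ c)) (trans (n∸n≡0 c) (sym (m≤n⇒m∸n≡0 (n≤1+n c)))))
         (sym (stage c (<⇒≤ c<n)))
  rec : ∀ u → c ≤ u → u < c + k → g (suc u) ≡ toggle (at U (suc (suc u))) (g u) (at U (suc u))
  rec u c≤u u<c+k = trans (nu-interior-at T c u c≤u u+1<n)
    (sym (cong₂ (λ x z → toggle x (g u) z) (stage (suc (suc u)) u+1<n) (stage (suc u) (<⇒≤ u+1<n))))
    where
    u+1<n : suc u < n
    u+1<n = subst (suc u <_) fills (s≤s u<c+k)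
  inside : ∀ t → c < t → t < n → at (upFrom (suc c) k U) t ≡ g t
  inside (suc t) (s≤s c≤t) t<n =
    upFrom-inside c k U g (subst (c + k <_) fills ≤-refl) g₀ rec t c≤t
      (≤-pred (subst (suc t <_) (sym fills) t<n))
  rightBoundary : ∀ j → nu T j (n ∸ n) ≡ at T n
  rightBoundary j = trans (cong (nu T j) (n∸n≡0 n)) (nu-rightBoundary T j)
  byPosition : ∀ t → t ≤ n → at (upFrom (suc c) k U) t ≡ g t
  byPosition t t≤n with t ≤? c | m≤n⇒m<n∨m≡n t≤n
  ... | yes t≤c | _ = trans (upFrom-outside (suc c) k U t (inj₁ (s≤s t≤c)))
    (trans (stage t t≤n)
      (cong (λ z → nu T z (n ∸ t)) (trans (m≤n⇒m∸n≡0 (m≤n⇒m≤1+n t≤c)) (sym (m≤n⇒m∸n≡0 t≤c)))))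
  ... | no t≰c | inj₁ t<n = inside t (≰⇒> t≰c) t<n
  ... | no _   | inj₂ refl = trans (upFrom-outside (suc c) k U n (inj₂ (≤-reflexive fills)))
    (trans (stage n ≤-refl) (trans (rightBoundary (n ∸ suc c)) (sym (rightBoundary (n ∸ c)))))

dualEvacBK-nuEdge : (T U : Seq r n) (c : ℕ) → c < n →
  (∀ t → t ≤ n → at U t ≡ nu T (t ∸ c) (n ∸ t)) →
  ∀ t → t ≤ n → at (dualEvacBK n c U) t ≡ nu T t (n ∸ t)
dualEvacBK-nuEdge T U zero    _   stage = stage
dualEvacBK-nuEdge {n = n} T U (suc c) c<n stage =
  dualEvacBK-nuEdge T (upFrom (suc c) (n ∸ suc c) U) c c′<n (upFrom-nuStage T U c c′<n stage)
  where c′<n = <-trans (n<1+n c) c<n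

dualEvacuation≡dualEvacBK : (T : Seq r (suc n)) → dualEvacuation T ≡ dualEvacBK (suc n) n T
dualEvacuation≡dualEvacBK {n = n} T = at-ext _ _ λ t t<n+2 →
  trans (at-tabulate (λ t → nu T t (suc n ∸ t)) t t<n+2)
    (sym (dualEvacBK-nuEdge T T n ≤-refl leftColumn t (≤-pred t<n+2)))
  where
  leftColumn : ∀ t → t ≤ suc n → at T t ≡ nu T (t ∸ n) (suc n ∸ t)
  leftColumn t t≤n+1 with m≤n⇒m<n∨m≡n t≤n+1
  ... | inj₁ (s≤s t≤n) rewrite m≤n⇒m∸n≡0 t≤n = sym (nu-leftColumn T t t≤n+1)
  ... | inj₂ refl rewrite n∸n≡0 (suc n) = sym (nu-rightBoundary T (suc n ∸ n))

lemma4p5 : (r n : ℕ) (T : Seq r n) →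
    IsFluctuatingTableau T → NonSkew T →
    (promotion T ≡ bkUp (n ∸ 1) T)
    × (evacuation T ≡ evacBK (n ∸ 1) T)
    × (dualEvacuation T ≡ dualEvacBK n (n ∸ 1) T)
lemma4p5 r zero    (x ∷ []) _ _ = refl , refl , refl
lemma4p5 r (suc n) T        _ _ = promotion≡bkUp T , evacuation≡evacBK T , dualEvacuation≡dualEvacBK T
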